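{- Let $\varepsilon$ be an integer with $\varepsilon\equiv 0\pmod{4}$. Then there exist infinitely many positive odd integers $n$ with the property that there exist positive integers $d_1, d_2$, both dividing $\frac{n^2+1}{2}$, such that $d_1+d_2=2n+\varepsilon$. -}

module Defs where

open import Data.Nat using (ℕ; _+_; _*_; _/_; _<_)
open import Data.Nat.Divisibility using (_∣_)
open import Data.Integer as ℤ using (ℤ; +_)
open import Data.Product using (Σ; ∃; _×_; ∃-syntax)
open import Relation.Binary.PropositionalEquality using (_≡_)

Odd : ℕ → Set
Odd n = ∃[ k ] (n ≡ 2 * k + 1)

-- (n² + 1) / 2, natural-number division (exact when n is odd)
half[n²+1] : ℕ → ℕ
half[n²+1] n = (n * n + 1) / 2

HasProperty : ℤ → ℕ → Set
HasProperty ε n =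
  ∃[ d₁ ] ∃[ d₂ ] (0 < d₁ × 0 < d₂ × d₁ ∣ half[n²+1] n × d₂ ∣ half[n²+1] n
                   × (+ d₁ ℤ.+ + d₂ ≡ + (2 * n) ℤ.+ ε))

{-# OPTIONS --safe #-}
module Submission where

-- Write d₁ = a ≤ d₂ = b. It suffices to find, for one fixed c, infinitely many n with
--   n² + 1 = 2c·a·b  and  a + b = 2n + ε,
-- because then a and b divide c·a·b = (n² + 1)/2. Eliminating a, n is a root of
-- X² − 4cb·X + 2cb(b − ε) + 1, so n′ = 4cb − n gives another solution (n′, b, 2n′ + ε − b)
-- (Vieta jumping). While b − a < 2cb − n, the jump strictly increases n, keeps a ≤ b and
-- preserves this inequality. Starting points, with c = 2t² + 2t + 1: (2t + 1, 1, 1) when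
-- ε = −4t, and for ε = 4(t + 1) the jump of the solution (−(2t + 1), 1, 1).

open import Defs
open import Data.Nat using (ℕ; suc; _+_; _*_; _∸_; _/_; _≤_; _<_; NonZero; z≤n; s≤s; z<s)
open import Data.Nat.Properties
open import Data.Nat.DivMod using (m*n/n≡m)
import Data.Nat.Divisibility as ℕ
open import Data.Nat.Tactic.RingSolver using (solve-∀)
open import Data.Integer using (ℤ; +_)
import Data.Integer as ℤ
open import Data.Integer.Divisibility using (_∣_)
open import Data.Integer.Properties using (pos-+)
import Data.Integer.Tactic.RingSolver as ℤ-Solver
open import Data.Product using (_×_; _,_; ∃-syntax)
open import Data.Sum using (_⊎_; inj₁; inj₂)
open import Relation.Binary.PropositionalEquality
  using (_≡_; refl; sym; trans; cong; cong₂; module ≡-Reasoning)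

odd-+-even : ∀ {n} m → Odd n → Odd (n + 2 * m)
odd-+-even m (j , refl) = j + m , shift j m
  where
  shift : ∀ j m → 2 * j + 1 + 2 * m ≡ 2 * (j + m) + 1
  shift = solve-∀

2*m/2≡m : ∀ m → 2 * m / 2 ≡ m
2*m/2≡m m = trans (cong (_/ 2) (*-comm 2 m)) (m*n/n≡m m 2)

<-by-gap : ∀ {x y} g → x + suc g ≡ y → x < y
<-by-gap g refl = m<m+n _ z<s

pos-+-cong : ∀ a b c d → a + b ≡ c + d → + a ℤ.+ + b ≡ + c ℤ.+ + d
pos-+-cong a b c d eq = trans (sym (pos-+ a b)) (trans (cong +_ eq) (pos-+ c d))

vieta-product : ∀ c n a b δ → n * n + 1 ≡ 2 * (c * (a * b)) → n + δ ≡ 2 * c * b →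
                (n + 2 * δ) * (n + 2 * δ) + 1 ≡ 2 * (c * (b * (a + 4 * δ)))
vieta-product c n a b δ product n+δ≡2cb = begin
  (n + 2 * δ) * (n + 2 * δ) + 1            ≡⟨ expand n δ ⟩
  (n * n + 1) + 4 * δ * (n + δ)            ≡⟨ cong₂ (λ x y → x + 4 * δ * y) product n+δ≡2cb ⟩
  2 * (c * (a * b)) + 4 * δ * (2 * c * b)  ≡⟨ collect c a b δ ⟩
  2 * (c * (b * (a + 4 * δ)))              ∎
  where
  open ≡-Reasoning
  expand : ∀ n δ → (n + 2 * δ) * (n + 2 * δ) + 1 ≡ (n * n + 1) + 4 * δ * (n + δ)
  expand = solve-∀
  collect : ∀ c a b δ → 2 * (c * (a * b)) + 4 * δ * (2 * c * b) ≡ 2 * (c * (b * (a + 4 * δ)))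
  collect = solve-∀

vieta-sum : ∀ ε n a b δ → + a ℤ.+ + b ≡ + (2 * n) ℤ.+ ε →
            + b ℤ.+ + (a + 4 * δ) ≡ + (2 * (n + 2 * δ)) ℤ.+ ε
vieta-sum ε n a b δ sum = begin
  + b ℤ.+ + (a + 4 * δ)               ≡⟨ cong (λ x → + b ℤ.+ x) (pos-+ a (4 * δ)) ⟩
  + b ℤ.+ (+ a ℤ.+ + (4 * δ))         ≡⟨ regroup (+ a) (+ b) (+ (4 * δ)) ⟩
  (+ a ℤ.+ + b) ℤ.+ + (4 * δ)         ≡⟨ cong (λ x → x ℤ.+ + (4 * δ)) sum ⟩
  (+ (2 * n) ℤ.+ ε) ℤ.+ + (4 * δ)     ≡⟨ swap (+ (2 * n)) ε (+ (4 * δ)) ⟩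
  (+ (2 * n) ℤ.+ + (4 * δ)) ℤ.+ ε     ≡⟨ cong (λ x → x ℤ.+ ε) (sym (pos-+ (2 * n) (4 * δ))) ⟩
  + (2 * n + 4 * δ) ℤ.+ ε             ≡⟨ cong (λ x → + x ℤ.+ ε) (double n δ) ⟩
  + (2 * (n + 2 * δ)) ℤ.+ ε           ∎
  where
  open ≡-Reasoning
  regroup : ∀ x y z → y ℤ.+ (x ℤ.+ z) ≡ (x ℤ.+ y) ℤ.+ z
  regroup = ℤ-Solver.solve-∀
  swap : ∀ x y z → (x ℤ.+ y) ℤ.+ z ≡ (x ℤ.+ z) ℤ.+ y
  swap = ℤ-Solver.solve-∀
  double : ∀ n δ → 2 * n + 4 * δ ≡ 2 * (n + 2 * δ)
  double = solve-∀

module VietaJumping (c : ℕ) .{{_ : NonZero c}} (ε : ℤ) where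

  record Solution : Set where
    field
      n a b   : ℕ
      n-odd   : Odd n
      sum     : + a ℤ.+ + b ≡ + (2 * n) ℤ.+ ε
      product : n * n + 1 ≡ 2 * (c * (a * b))
      0<a     : 0 < a
      a≤b     : a ≤ b
      room    : n + b < a + 2 * c * b

  hasProperty : (σ : Solution) → HasProperty ε (Solution.n σ)
  hasProperty σ = a , b , 0<a , <-≤-trans 0<a a≤b ,
                  ℕ.∣-trans (ℕ.m∣m*n b) ab∣half , ℕ.∣-trans (ℕ.n∣m*n a) ab∣half , sum
    where
    open Solution σ
    ab∣half : a * b ℕ.∣ half[n²+1] n
    ab∣half = ℕ.divides c (trans (cong (_/ 2) product) (2*m/2≡m (c * (a * b))))

  module Jump (σ : Solution) where
    open Solution σ

    δ : ℕ
    δ = 2 * c * b ∸ n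

    n<2cb : n < 2 * c * b
    n<2cb = +-cancelʳ-< b n (2 * c * b) (begin-strict
      n + b          <⟨ room ⟩
      a + 2 * c * b  ≤⟨ +-monoˡ-≤ (2 * c * b) a≤b ⟩
      b + 2 * c * b  ≡⟨ +-comm b (2 * c * b) ⟩
      2 * c * b + b  ∎)
      where open ≤-Reasoning

    n+δ≡2cb : n + δ ≡ 2 * c * b
    n+δ≡2cb = m+[n∸m]≡n (<⇒≤ n<2cb)

    b<a+δ : b < a + δ
    b<a+δ = +-cancelˡ-< n b (a + δ) (begin-strict
      n + b          <⟨ room ⟩
      a + 2 * c * b  ≡⟨ cong (λ x → a + x) (sym n+δ≡2cb) ⟩
      a + (n + δ)    ≡⟨ +-comm-middle a n δ ⟩
      n + (a + δ)    ∎)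
      where
      open ≤-Reasoning
      +-comm-middle : ∀ a n δ → a + (n + δ) ≡ n + (a + δ)
      +-comm-middle = solve-∀

    n<n′ : n < n + 2 * δ
    n<n′ = m<m+n n (≤-trans (m<n⇒0<n∸m n<2cb) (m≤n*m δ 2))

    room′ : (n + 2 * δ) + (a + 4 * δ) < b + 2 * c * (a + 4 * δ)
    room′ = begin-strict
      (n + 2 * δ) + (a + 4 * δ)          ≡⟨ split n a δ ⟩
      (n + δ) + a + 5 * δ                ≡⟨ cong (λ x → x + a + 5 * δ) n+δ≡2cb ⟩
      2 * c * b + a + 5 * δ              <⟨ +-mono-<-≤ (+-mono-<-≤ 2cb<2c[a+δ] a≤b) 5δ≤6cδ ⟩
      2 * c * (a + δ) + b + 6 * c * δ    ≡⟨ merge c a b δ ⟩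
      b + 2 * c * (a + 4 * δ)            ∎
      where
      open ≤-Reasoning
      2cb<2c[a+δ] : 2 * c * b < 2 * c * (a + δ)
      2cb<2c[a+δ] = *-monoʳ-< (2 * c) {{m*n≢0 2 c}} b<a+δ
      5δ≤6cδ : 5 * δ ≤ 6 * c * δ
      5δ≤6cδ = *-monoˡ-≤ δ (≤-trans (n≤1+n 5) (m≤m*n 6 c))
      split : ∀ n a δ → (n + 2 * δ) + (a + 4 * δ) ≡ (n + δ) + a + 5 * δ
      split = solve-∀
      merge : ∀ c a b δ → 2 * c * (a + δ) + b + 6 * c * δ ≡ b + 2 * c * (a + 4 * δ)
      merge = solve-∀

    jump : Solution
    jump = record
      { n       = n + 2 * δ
      ; a       = b
      ; b       = a + 4 * δ
      ; n-odd   = odd-+-even δ n-odd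
      ; sum     = vieta-sum ε n a b δ sum
      ; product = vieta-product c n a b δ product n+δ≡2cb
      ; 0<a     = <-≤-trans 0<a a≤b
      ; a≤b     = ≤-trans (<⇒≤ b<a+δ) (+-monoʳ-≤ a (m≤n*m δ 4))
      ; room    = room′
      }

  open Jump using (jump; n<n′)

  exceeds : Solution → ∀ N → ∃[ τ ] N < Solution.n τ
  exceeds σ 0       = jump σ , ≤-<-trans z≤n (n<n′ σ)
  exceeds σ (suc N) with exceeds σ N
  ... | τ , N<n = jump τ , ≤-<-trans N<n (n<n′ τ)

  infinitelyMany : Solution → ∀ N → ∃[ n ] (N < n × Odd n × HasProperty ε n)
  infinitelyMany σ N with exceeds σ N
  ... | τ , N<n = Solution.n τ , N<n , Solution.n-odd τ , hasProperty τ

open VietaJumping using (Solution; infinitelyMany)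

centredSquare : ℕ → ℕ
centredSquare t = 1 + 2 * t * (1 + t)

room-if-n≤b : ∀ c .{{_ : NonZero c}} n a b → 0 < a → n ≤ b → n + b < a + 2 * c * b
room-if-n≤b c n a b 0<a n≤b = begin-strict
  n + b          ≤⟨ +-monoˡ-≤ b n≤b ⟩
  b + b          ≡⟨ cong (λ x → b + x) (sym (+-identityʳ b)) ⟩
  2 * b          ≤⟨ *-monoˡ-≤ b (m≤m*n 2 c) ⟩
  2 * c * b      <⟨ m<n+m (2 * c * b) 0<a ⟩
  a + 2 * c * b  ∎
  where open ≤-Reasoning

seed-nonpositive : ∀ t → Solution (centredSquare t) (ℤ.- + (4 * t))
seed-nonpositive t = record
  { n       = 2 * t + 1
  ; a       = 1
  ; b       = 1
  ; n-odd   = t , refl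
  ; sum     = sum
  ; product = product t
  ; 0<a     = z<s
  ; a≤b     = ≤-refl
  ; room    = <-by-gap (2 * t * (2 * t + 1)) (room t)
  }
  where
  open ≡-Reasoning
  sum : + 1 ℤ.+ + 1 ≡ + (2 * (2 * t + 1)) ℤ.+ ℤ.- + (4 * t)
  sum = begin
    + 1 ℤ.+ + 1                                ≡⟨ cancel (+ (4 * t)) ⟩
    (+ (4 * t) ℤ.+ + 2) ℤ.+ ℤ.- + (4 * t)      ≡⟨ cong (λ x → x ℤ.+ ℤ.- + (4 * t)) (sym (pos-+ (4 * t) 2)) ⟩
    + (4 * t + 2) ℤ.+ ℤ.- + (4 * t)            ≡⟨ cong (λ x → + x ℤ.+ ℤ.- + (4 * t)) (double t) ⟩
    + (2 * (2 * t + 1)) ℤ.+ ℤ.- + (4 * t)      ∎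
    where
    cancel : ∀ x → + 1 ℤ.+ + 1 ≡ (x ℤ.+ + 2) ℤ.+ ℤ.- x
    cancel = ℤ-Solver.solve-∀
    double : ∀ t → 4 * t + 2 ≡ 2 * (2 * t + 1)
    double = solve-∀
  product : ∀ t → (2 * t + 1) * (2 * t + 1) + 1 ≡ 2 * ((1 + 2 * t * (1 + t)) * (1 * 1))
  product = solve-∀
  room : ∀ t → (2 * t + 1 + 1) + suc (2 * t * (2 * t + 1)) ≡ 1 + 2 * (1 + 2 * t * (1 + t)) * 1
  room = solve-∀

-- (n₀, 1, b₀) is the jump of (−(2t + 1), 1, 1), which solves both equations but has n < 0.
seed-positive : ∀ t → Solution (centredSquare t) (+ (4 * suc t))
seed-positive t = record
  { n       = n₀
  ; a       = 1
  ; b       = b₀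
  ; n-odd   = 2 * centredSquare t + t , odd t
  ; sum     = pos-+-cong 1 b₀ (2 * n₀) (4 * suc t) (sum n₀ t)
  ; product = product t
  ; 0<a     = z<s
  ; a≤b     = ≤-trans (s≤s z≤n) (m≤n+m (3 + 4 * t) (2 * n₀))
  ; room    = room-if-n≤b (centredSquare t) n₀ 1 b₀ z<s n₀≤b₀
  }
  where
  n₀ b₀ : ℕ
  n₀ = 4 * centredSquare t + (2 * t + 1)
  b₀ = 2 * n₀ + (3 + 4 * t)
  n₀≤b₀ : n₀ ≤ b₀
  n₀≤b₀ = ≤-trans (m≤n*m n₀ 2) (m≤m+n (2 * n₀) (3 + 4 * t))
  odd : ∀ t → 4 * (1 + 2 * t * (1 + t)) + (2 * t + 1) ≡ 2 * (2 * (1 + 2 * t * (1 + t)) + t) + 1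
  odd = solve-∀
  sum : ∀ n t → 1 + (2 * n + (3 + 4 * t)) ≡ 2 * n + 4 * suc t
  sum = solve-∀
  product : ∀ t → let c = 1 + 2 * t * (1 + t); n = 4 * c + (2 * t + 1) in
            n * n + 1 ≡ 2 * (c * (1 * (2 * n + (3 + 4 * t))))
  product = solve-∀

multiple-of-4 : ∀ ε → + 4 ∣ ε → (∃[ t ] ε ≡ ℤ.- + (4 * t)) ⊎ (∃[ t ] ε ≡ + (4 * suc t))
multiple-of-4 (+ 0)      _                       = inj₁ (0 , refl)
multiple-of-4 (+ suc e)  (ℕ.divides (suc t) eq) = inj₂ (t , cong +_ (trans eq (*-comm (suc t) 4)))
multiple-of-4 ℤ.-[1+ e ] (ℕ.divides q eq)       = inj₁ (q , cong (λ x → ℤ.- + x) (trans eq (*-comm q 4)))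

theorem1 : (ε : ℤ) → (+ 4) ∣ ε →
    (N : ℕ) → ∃[ n ] (N < n × Odd n × HasProperty ε n)
theorem1 ε 4∣ε N with multiple-of-4 ε 4∣ε
... | inj₁ (t , refl) = infinitelyMany _ _ (seed-nonpositive t) N
... | inj₂ (t , refl) = infinitelyMany _ _ (seed-positive t) N
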